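{- For all formulas $\varphi,\psi$: $\varphi,\varphi^{*}\vdash_{\mathsf{NeL}+\{(\mathrm{DI})^{s}\}}\psi$.
   Context: Formulas: built from countably many variables with binary $\otimes,\circ$ and unary ${}^{*}$. Abbreviations: $\varphi\Rightarrow\psi:=(\varphi\circ\psi^{*})^{*}$; $\varphi\Leftrightarrow\psi:=(\varphi\Rightarrow\psi)\otimes(\psi\Rightarrow\varphi)$; $\varphi\not\Leftrightarrow\psi:=(\varphi\Leftrightarrow\psi)^{*}$; $\varphi\not\Leftrightarrow\psi\not\Leftrightarrow\chi:=((\varphi\not\Leftrightarrow\psi)\otimes(\varphi\not\Leftrightarrow\chi))\otimes(\psi\not\Leftrightarrow\chi)$; $\varphi\oplus\psi:=(\varphi^{*}\otimes\psi^{*})^{*}$. $\Gamma\vdash_{\mathsf{NeL}+\{(\mathrm{DI})^{s}\}}\varphi$ means $\varphi$ has a finite derivation from $\Gamma$ and instances of (A1) $\varphi\Rightarrow\varphi$; (A2) $(\varphi\circ\psi)\Rightarrow(\psi\circ\varphi)$; (A3) $\varphi\Rightarrow\varphi^{**}$; (A4) $(\varphi\Rightarrow\psi)\Rightarrow(\varphi\circ\psi)$; (A5) $(\varphi\otimes\psi)\Leftrightarrow(\psi\otimes\varphi)$; (A6) $((\varphi\otimes\psi)\Rightarrow\chi)\Rightarrow((\varphi\otimes\chi^{*})\Rightarrow\psi^{*})$; (A7) $(\varphi\not\Leftrightarrow\psi\not\Leftrightarrow\chi)\Rightarrow((\varphi\Rightarrow\psi)\Rightarrow((\psi\Rightarrow\chi)\Rightarrow(\varphi\Rightarrow\chi)))$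 using the rules: from $\varphi\Rightarrow\psi,\varphi$ infer $\psi$; from $\varphi,\psi$ infer $\varphi\otimes\psi$; from $\varphi\Leftrightarrow\psi$ and $\chi$ infer $\chi'$ ($\chi'$ from $\chi$ by replacing one or more occurrences of $\varphi$ by $\psi$); from $\varphi\otimes\psi$ infer $\varphi$; from $\varphi$ infer $\varphi\oplus\psi$. -}

module Defs where

open import Data.Nat using (ℕ)
open import Data.Sum using (_⊎_)
open import Relation.Binary.PropositionalEquality using (_≡_)

data Formula : Set where
  var  : ℕ → Formula
  _⊗_  : Formula → Formula → Formula
  _∘_  : Formula → Formula → Formula
  _*   : Formula → Formula

infixl 30 _*
infixr 20 _⊗_ _∘_

_⇒_ : Formula → Formula → Formula
φ ⇒ ψ = (φ ∘ (ψ *)) *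

_⇔_ : Formula → Formula → Formula
φ ⇔ ψ = (φ ⇒ ψ) ⊗ (ψ ⇒ φ)

_⇎_ : Formula → Formula → Formula
φ ⇎ ψ = (φ ⇔ ψ) *

⇎3 : Formula → Formula → Formula → Formula
⇎3 φ ψ χ = ((φ ⇎ ψ) ⊗ (φ ⇎ χ)) ⊗ (ψ ⇎ χ)

_⊕_ : Formula → Formula → Formula
φ ⊕ ψ = ((φ *) ⊗ (ψ *)) *

infixr 10 _⇒_ _⇔_ _⇎_ _⊕_

-- Replacement relation: Repl φ ψ χ χ' holds iff χ' is obtained from χ by
-- replacing some occurrences of φ by ψ.
-- ReplAny allows zero replacements; Repl requires at least one.
data ReplAny (φ ψ : Formula) : Formula → Formula → Set where
  here   : ReplAny φ ψ φ ψ
  keep   : ∀ {χ} → ReplAny φ ψ χ χ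
  ⊗-cong : ∀ {a a' b b'} → ReplAny φ ψ a a' → ReplAny φ ψ b b' → ReplAny φ ψ (a ⊗ b) (a' ⊗ b')
  ∘-cong : ∀ {a a' b b'} → ReplAny φ ψ a a' → ReplAny φ ψ b b' → ReplAny φ ψ (a ∘ b) (a' ∘ b')
  *-cong : ∀ {a a'} → ReplAny φ ψ a a' → ReplAny φ ψ (a *) (a' *)

data Repl (φ ψ : Formula) : Formula → Formula → Set where
  here    : Repl φ ψ φ ψ
  ⊗-congˡ : ∀ {a a' b b'} → Repl φ ψ a a' → ReplAny φ ψ b b' → Repl φ ψ (a ⊗ b) (a' ⊗ b')
  ⊗-congʳ : ∀ {a a' b b'} → ReplAny φ ψ a a' → Repl φ ψ b b' → Repl φ ψ (a ⊗ b) (a' ⊗ b')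
  ∘-congˡ : ∀ {a a' b b'} → Repl φ ψ a a' → ReplAny φ ψ b b' → Repl φ ψ (a ∘ b) (a' ∘ b')
  ∘-congʳ : ∀ {a a' b b'} → ReplAny φ ψ a a' → Repl φ ψ b b' → Repl φ ψ (a ∘ b) (a' ∘ b')
  *-cong  : ∀ {a a'} → Repl φ ψ a a' → Repl φ ψ (a *) (a' *)

data Axiom : Formula → Set where
  A1 : ∀ φ → Axiom (φ ⇒ φ)
  A2 : ∀ φ ψ → Axiom ((φ ∘ ψ) ⇒ (ψ ∘ φ))
  A3 : ∀ φ → Axiom (φ ⇒ φ * *)
  A4 : ∀ φ ψ → Axiom ((φ ⇒ ψ) ⇒ (φ ∘ ψ))
  A5 : ∀ φ ψ → Axiom ((φ ⊗ ψ) ⇔ (ψ ⊗ φ))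
  A6 : ∀ φ ψ χ → Axiom (((φ ⊗ ψ) ⇒ χ) ⇒ ((φ ⊗ (χ *)) ⇒ (ψ *)))
  A7 : ∀ φ ψ χ → Axiom (⇎3 φ ψ χ ⇒ ((φ ⇒ ψ) ⇒ ((ψ ⇒ χ) ⇒ (φ ⇒ χ))))

data _⊢_ (Γ : Formula → Set) : Formula → Set where
  assm : ∀ {φ} → Γ φ → Γ ⊢ φ
  ax   : ∀ {φ} → Axiom φ → Γ ⊢ φ
  mp   : ∀ {φ ψ} → Γ ⊢ (φ ⇒ ψ) → Γ ⊢ φ → Γ ⊢ ψ
  adj  : ∀ {φ ψ} → Γ ⊢ φ → Γ ⊢ ψ → Γ ⊢ (φ ⊗ ψ)
  sub  : ∀ {φ ψ χ χ'} → Γ ⊢ (φ ⇔ ψ) → Γ ⊢ χ → Repl φ ψ χ χ' → Γ ⊢ χ'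
  elim : ∀ {φ ψ} → Γ ⊢ (φ ⊗ ψ) → Γ ⊢ φ
  add  : ∀ {φ ψ} → Γ ⊢ φ → Γ ⊢ (φ ⊕ ψ)

infix 4 _⊢_

⟨_,_⟩ : Formula → Formula → Formula → Set
⟨ φ , ψ ⟩ χ = (χ ≡ φ) ⊎ (χ ≡ ψ)

{-# OPTIONS --safe #-}
-- Lewis's argument: the addition rule turns φ into φ ⊕ ψ, and disjunctive
-- syllogism against φ * then yields ψ.
module Submission where

open import Defs
open import Data.Sum using (inj₁; inj₂)
open import Relation.Binary.PropositionalEquality using (refl)

module _ {Γ : Formula → Set} where

  ∘-comm : ∀ {φ ψ} → Γ ⊢ (φ ∘ ψ) ⇔ (ψ ∘ φ)
  ∘-comm {φ} {ψ} = adj (ax (A2 φ ψ)) (ax (A2 ψ φ))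

  -- A1 at φ * is (φ * ∘ φ * *) *; commuting ∘ under the star gives φ * * ⇒ φ.
  **-elim : ∀ {φ} → Γ ⊢ φ * * ⇒ φ
  **-elim {φ} = sub ∘-comm (ax (A1 (φ *))) (*-cong here)

  ⊗-antilogism : ∀ {φ ψ χ} → Γ ⊢ (φ ⊗ ψ) ⇒ χ → Γ ⊢ (φ ⊗ χ *) ⇒ ψ *
  ⊗-antilogism {φ} {ψ} {χ} = mp (ax (A6 φ ψ χ))

  -- φ ⊕ ψ is (φ * ⊗ ψ *) *, so antilogism on the identity of φ * ⊗ ψ *
  -- yields (φ * ⊗ (φ ⊕ ψ)) ⇒ ψ * *.
  disjunctive-syllogism : ∀ {φ ψ} → Γ ⊢ φ * → Γ ⊢ φ ⊕ ψ → Γ ⊢ ψ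
  disjunctive-syllogism {φ} {ψ} ⊢φ* ⊢φ⊕ψ =
    mp **-elim (mp (⊗-antilogism (ax (A1 (φ * ⊗ ψ *)))) (adj ⊢φ* ⊢φ⊕ψ))

proposition5p13 : ∀ (φ ψ : Formula) → ⟨ φ , φ * ⟩ ⊢ ψ
proposition5p13 φ ψ = disjunctive-syllogism (assm (inj₂ refl)) (add (assm (inj₁ refl)))
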